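{- Let $\xi\in\mathbb{F}_{2^n}^*$ and $a\in\mathbb{F}_{2^n}$ with $a\neq0$ and $a\neq\sqrt{\xi}$. Define the sequence $S_a=(a_i)_{i\ge0}$ by $a_0=a$, $a_1=a+\xi/a$ and $a_{i+1}=a_{i-1}+\xi/a_i$ for $i\ge1$ (with the convention $u/0:=0$). Then for all $i\ge0$, $$a_{2i}=a\left(\frac{a^2}{a^2+\xi}\right)^i,\qquad a_{2i+1}=a\left(\frac{a^2+\xi}{a^2}\right)^{i+1},$$ and the period of $S_a$ is $2\cdot\mathrm{ord}(1+\xi/a^2)$, where $\mathrm{ord}$ denotes multiplicative order in $\mathbb{F}_{2^n}^*$. -}

module Defs where

open import Level using (0ℓ)
open import Data.Nat using (ℕ; zero; suc; _^_; _≤_)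
import Data.Nat as ℕ
open import Data.Product using (_×_)
open import Data.Fin using (Fin)
open import Algebra.Bundles using (CommutativeRing)
open import Relation.Nullary using (¬_)
open import Relation.Binary.Definitions using (Decidable)
open import Relation.Binary.PropositionalEquality using () renaming (setoid to ≡-setoid)
open import Function.Bundles using (Inverse)

-- A field with exactly 2^n elements (hence a model of F_{2^n}, unique up to
-- isomorphism).  Equality is the ring's setoid equality _≈_, assumed decidable.
-- `inv` is the multiplicative inverse, extended by the convention inv 0 = 0,
-- so that u / v := u * inv v realises the paper's convention u/0 := 0.
record GF2^ (n : ℕ) : Set₁ where
  field
    commRing : CommutativeRing 0ℓ 0ℓ
  open CommutativeRing commRing public
  field
    _≟_      : Decidable _≈_
    0≉1      : ¬ (0# ≈ 1#)
    inv      : Carrier → Carrier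
    inv-0    : inv 0# ≈ 0#
    inverse  : ∀ x → ¬ (x ≈ 0#) → x * inv x ≈ 1#
    char2    : 1# + 1# ≈ 0#   -- redundant (follows from card), recorded for convenience
    card     : Inverse setoid (≡-setoid (Fin (2 ^ n)))

module _ {n : ℕ} (F : GF2^ n) where
  open GF2^ F

  div : Carrier → Carrier → Carrier
  div u v = u * inv v

  pow : Carrier → ℕ → Carrier
  pow x zero    = 1#
  pow x (suc k) = x * pow x k

  seqS : (ξ a : Carrier) → ℕ → Carrier
  seqS ξ a zero          = a
  seqS ξ a (suc zero)    = a + div ξ a
  seqS ξ a (suc (suc i)) = seqS ξ a i + div ξ (seqS ξ a (suc i))

  IsOrder : Carrier → ℕ → Set
  IsOrder x k = 1 ≤ k × pow x k ≈ 1# × (∀ m → 1 ≤ m → pow x m ≈ 1# → k ≤ m)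

  IsPeriod : (ℕ → Carrier) → ℕ → Set
  IsPeriod s p = 1 ≤ p × (∀ i → s (i ℕ.+ p) ≈ s i)
               × (∀ q → 1 ≤ q → (∀ i → s (i ℕ.+ q) ≈ s i) → p ≤ q)

module Submission where

-- Write b = a², c = a² + ξ, u = b/c and v = c/b = 1 + ξ/a², so that uv = 1.
-- In characteristic 2 one has a + ξ/a = av and a + ξu/a = au; feeding these into
-- the recurrence gives a_{2i} = a uⁱ and a_{2i+1} = a vⁱ⁺¹ by induction.  Hence
-- 2k is a period as soon as uᵏ = 1, an even period 2j forces uʲ = 1, and an odd
-- period would force v = 1, i.e. ξ = 0.

open import Defs
open import Data.Nat using (ℕ; zero; suc; z≤n; s≤s)
import Data.Nat as ℕ
import Data.Nat.Properties as ℕ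
open import Data.Product using (_×_; _,_; ∃; proj₁; proj₂)
open import Data.Sum using (_⊎_; inj₁; inj₂)
open import Data.Empty using (⊥-elim)
open import Function using (_∘_)
open import Relation.Nullary using (¬_)
open import Relation.Binary.PropositionalEquality as ≡ using (_≡_)
import Relation.Binary.Reasoning.Setoid as SetoidReasoning

even-or-odd : ∀ m → (∃ λ j → m ≡ 2 ℕ.* j) ⊎ (∃ λ j → m ≡ suc (2 ℕ.* j))
even-or-odd zero = inj₁ (0 , ≡.refl)
even-or-odd (suc m) with even-or-odd m
... | inj₁ (j , ≡.refl) = inj₂ (j , ≡.refl)
... | inj₂ (j , ≡.refl) = inj₁ (suc j , ≡.sym (ℕ.*-suc 2 j))

module FieldProperties {n : ℕ} (F : GF2^ n) where
  open GF2^ F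
  open SetoidReasoning setoid
  open import Algebra.Properties.Semiring.Exp semiring using (_^_; ^-congˡ; ^-homo-*)
  open import Algebra.Properties.Group +-group using (inverseʳ-unique; x∙y⁻¹≈ε⇒x≈y)
  open import Algebra.Solver.Ring.NaturalCoefficients.Default commutativeSemiring
    using (solve; _:=_; _:+_; _:*_)

  x+x≈0 : ∀ x → x + x ≈ 0#
  x+x≈0 x = begin
    x + x           ≈⟨ +-cong (*-identityʳ x) (*-identityʳ x) ⟨
    x * 1# + x * 1# ≈⟨ distribˡ x 1# 1# ⟨
    x * (1# + 1#)   ≈⟨ *-congˡ char2 ⟩
    x * 0#          ≈⟨ zeroʳ x ⟩
    0#              ∎

  x+y≈0⇒x≈y : ∀ {x y} → x + y ≈ 0# → x ≈ y
  x+y≈0⇒x≈y {x} {y} x+y≈0 = x∙y⁻¹≈ε⇒x≈y x y (trans (+-congˡ -y≈y) x+y≈0)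
    where
    -y≈y : - y ≈ y
    -y≈y = sym (inverseʳ-unique y y (x+x≈0 y))

  x*y≈1⇒x≉0 : ∀ {x y} → x * y ≈ 1# → ¬ x ≈ 0#
  x*y≈1⇒x≉0 {x} {y} x*y≈1 x≈0 = 0≉1 (begin
    0#     ≈⟨ zeroˡ y ⟨
    0# * y ≈⟨ *-congʳ x≈0 ⟨
    x * y  ≈⟨ x*y≈1 ⟩
    1#     ∎)

  inv-unique : ∀ {x y} → x * y ≈ 1# → inv x ≈ y
  inv-unique {x} {y} x*y≈1 = begin
    inv x           ≈⟨ *-identityʳ (inv x) ⟨
    inv x * 1#      ≈⟨ *-congˡ x*y≈1 ⟨
    inv x * (x * y) ≈⟨ solve 3 (λ i x y → i :* (x :* y) := x :* i :* y) refl (inv x) x y ⟩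
    x * inv x * y   ≈⟨ *-congʳ (inverse x (x*y≈1⇒x≉0 x*y≈1)) ⟩
    1# * y          ≈⟨ *-identityˡ y ⟩
    y               ∎

  div-*-cancel : ∀ {y} → ¬ y ≈ 0# → ∀ x → div F x y * y ≈ x
  div-*-cancel {y} y≉0 x = begin
    x * inv y * y   ≈⟨ solve 3 (λ x i y → x :* i :* y := x :* (y :* i)) refl x (inv y) y ⟩
    x * (y * inv y) ≈⟨ *-congˡ (inverse y y≉0) ⟩
    x * 1#          ≈⟨ *-identityʳ x ⟩
    x               ∎

  *-cancelˡ-≉0 : ∀ {x y z} → ¬ x ≈ 0# → x * y ≈ x * z → y ≈ z
  *-cancelˡ-≉0 {x} {y} {z} x≉0 x*y≈x*z = begin
    y             ≈⟨ div-*-cancel x≉0 y ⟨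
    y * inv x * x ≈⟨ solve 3 (λ y i x → y :* i :* x := x :* y :* i) refl y (inv x) x ⟩
    x * y * inv x ≈⟨ *-congʳ x*y≈x*z ⟩
    x * z * inv x ≈⟨ solve 3 (λ z i x → x :* z :* i := z :* i :* x) refl z (inv x) x ⟩
    z * inv x * x ≈⟨ div-*-cancel x≉0 z ⟩
    z             ∎

  x*x≉0 : ∀ {x} → ¬ x ≈ 0# → ¬ x * x ≈ 0#
  x*x≉0 {x} x≉0 x*x≈0 = x≉0 (*-cancelˡ-≉0 x≉0 (trans x*x≈0 (sym (zeroʳ x))))

  div-*-div≈1 : ∀ {x y} → ¬ x ≈ 0# → ¬ y ≈ 0# → div F x y * div F y x ≈ 1#
  div-*-div≈1 {x} {y} x≉0 y≉0 = begin
    x * inv y * (y * inv x)   ≈⟨ solve 4 (λ x i y j → x :* j :* (y :* i) := x :* i :* (y :* j))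
                                    refl x (inv x) y (inv y) ⟩
    x * inv x * (y * inv y)   ≈⟨ *-cong (inverse x x≉0) (inverse y y≉0) ⟩
    1# * 1#                   ≈⟨ *-identityˡ 1# ⟩
    1#                        ∎

  inv-scaled-unit : ∀ {a x w w′} → ¬ a ≈ 0# → x ≈ a * w → w * w′ ≈ 1# → inv x ≈ inv a * w′
  inv-scaled-unit {a} {x} {w} {w′} a≉0 x≈a*w w*w′≈1 = inv-unique (begin
    x * (inv a * w′)     ≈⟨ *-congʳ x≈a*w ⟩
    a * w * (inv a * w′) ≈⟨ solve 4 (λ a w i w′ → a :* w :* (i :* w′) := a :* i :* (w :* w′))
                               refl a w (inv a) w′ ⟩
    a * inv a * (w * w′) ≈⟨ *-cong (inverse a a≉0) w*w′≈1 ⟩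
    1# * 1#              ≈⟨ *-identityˡ 1# ⟩
    1#                   ∎)

  pow≡^ : ∀ x k → pow F x k ≡ x ^ k
  pow≡^ x zero    = ≡.refl
  pow≡^ x (suc k) = ≡.cong (x *_) (pow≡^ x k)

  pow-congˡ : ∀ {x y} k → x ≈ y → pow F x k ≈ pow F y k
  pow-congˡ {x} {y} k x≈y = begin
    pow F x k ≡⟨ pow≡^ x k ⟩
    x ^ k     ≈⟨ ^-congˡ k x≈y ⟩
    y ^ k     ≡⟨ pow≡^ y k ⟨
    pow F y k ∎

  pow-+-≈1 : ∀ {x} k → pow F x k ≈ 1# → ∀ m → pow F x (m ℕ.+ k) ≈ pow F x m
  pow-+-≈1 {x} k xᵏ≈1 m = begin
    pow F x (m ℕ.+ k)     ≡⟨ pow≡^ x (m ℕ.+ k) ⟩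
    x ^ (m ℕ.+ k)         ≈⟨ ^-homo-* x m k ⟩
    x ^ m * x ^ k         ≡⟨ ≡.cong₂ _*_ (pow≡^ x m) (pow≡^ x k) ⟨
    pow F x m * pow F x k ≈⟨ *-congˡ xᵏ≈1 ⟩
    pow F x m * 1#        ≈⟨ *-identityʳ _ ⟩
    pow F x m             ∎

  pow-*-pow≈1 : ∀ {x y} → x * y ≈ 1# → ∀ k → pow F x k * pow F y k ≈ 1#
  pow-*-pow≈1 {x} {y} x*y≈1 zero    = *-identityˡ 1#
  pow-*-pow≈1 {x} {y} x*y≈1 (suc k) = begin
    x * X * (y * Y)  ≈⟨ solve 4 (λ x X y Y → x :* X :* (y :* Y) := x :* y :* (X :* Y)) refl x X y Y ⟩
    x * y * (X * Y)  ≈⟨ *-cong x*y≈1 (pow-*-pow≈1 x*y≈1 k) ⟩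
    1# * 1#          ≈⟨ *-identityˡ 1# ⟩
    1#               ∎
    where
    X Y : Carrier
    X = pow F x k
    Y = pow F y k

  pow≈1-transfer : ∀ {x y} → x * y ≈ 1# → ∀ k → pow F x k ≈ 1# → pow F y k ≈ 1#
  pow≈1-transfer {x} {y} x*y≈1 k xᵏ≈1 = begin
    pow F y k             ≈⟨ *-identityˡ _ ⟨
    1# * pow F y k        ≈⟨ *-congʳ xᵏ≈1 ⟨
    pow F x k * pow F y k ≈⟨ pow-*-pow≈1 x*y≈1 k ⟩
    1#                    ∎

module Orbit {n : ℕ} (F : GF2^ n) (ξ a : GF2^.Carrier F) where
  open GF2^ F
  open FieldProperties F
  open SetoidReasoning setoid
  open import Algebra.Properties.Group +-group using (∙-cancelˡ)
  open import Algebra.Solver.Ring.NaturalCoefficients.Default commutativeSemiring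
    using (solve; _:=_; _:+_; _:*_)

  s : ℕ → Carrier
  s = seqS F ξ a

  u v : Carrier
  u = div F (a * a) (a * a + ξ)
  v = div F (a * a + ξ) (a * a)

  Periodic : ℕ → Set
  Periodic q = ∀ i → s (i ℕ.+ q) ≈ s i

  module _ (ξ≉0 : ¬ ξ ≈ 0#) (a≉0 : ¬ a ≈ 0#) (a²≉ξ : ¬ a * a ≈ ξ) where

    a²≉0 : ¬ a * a ≈ 0#
    a²≉0 = x*x≉0 a≉0

    u*v≈1 : u * v ≈ 1#
    u*v≈1 = div-*-div≈1 a²≉0 (λ a²+ξ≈0 → a²≉ξ (x+y≈0⇒x≈y a²+ξ≈0))

    v*u≈1 : v * u ≈ 1#
    v*u≈1 = trans (*-comm v u) u*v≈1

    1+ξ/a²≈v : 1# + div F ξ (a * a) ≈ v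
    1+ξ/a²≈v = begin
      1# + ξ * inv (a * a)                  ≈⟨ +-congʳ (inverse (a * a) a²≉0) ⟨
      a * a * inv (a * a) + ξ * inv (a * a) ≈⟨ distribʳ (inv (a * a)) (a * a) ξ ⟨
      v                                     ∎

    v≉1 : ¬ v ≈ 1#
    v≉1 v≈1 = ξ≉0 (begin
      ξ                         ≈⟨ div-*-cancel a²≉0 ξ ⟨
      div F ξ (a * a) * (a * a) ≈⟨ *-congʳ ξ/a²≈0 ⟩
      0# * (a * a)              ≈⟨ zeroˡ (a * a) ⟩
      0#                        ∎)
      where
      ξ/a²≈0 : div F ξ (a * a) ≈ 0#
      ξ/a²≈0 = ∙-cancelˡ 1# _ _ (trans 1+ξ/a²≈v (trans v≈1 (sym (+-identityʳ 1#))))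

    a+ξ/a≈a*v : a + div F ξ a ≈ a * v
    a+ξ/a≈a*v = begin
      a + ξ * inv a                    ≈⟨ +-cong (sym (*-identityʳ a)) (*-congˡ inv-a) ⟩
      a * 1# + ξ * (a * inv (a * a))   ≈⟨ solve 4 (λ a ξ i o → a :* o :+ ξ :* (a :* i) := a :* (o :+ ξ :* i)) refl a ξ (inv (a * a)) 1# ⟩
      a * (1# + ξ * inv (a * a))       ≈⟨ *-congˡ 1+ξ/a²≈v ⟩
      a * v                            ∎
      where
      inv-a : inv a ≈ a * inv (a * a)
      inv-a = inv-unique (trans (sym (*-assoc a a _)) (inverse (a * a) a²≉0))

    -- (a + ξ/a) u = a v u = a, and adding a + au to both sides cancels in characteristic 2.
    a+ξu/a≈a*u : a + ξ * inv a * u ≈ a * u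
    a+ξu/a≈a*u = begin
      a + ξ * inv a * u                   ≈⟨ +-identityʳ _ ⟨
      a + ξ * inv a * u + 0#              ≈⟨ +-congˡ (x+x≈0 (a * u)) ⟨
      a + ξ * inv a * u + (a * u + a * u) ≈⟨ solve 4 (λ a ξ i u → a :+ ξ :* i :* u :+ (a :* u :+ a :* u)
                                                       := a :+ (a :+ ξ :* i) :* u :+ a :* u) refl a ξ (inv a) u ⟩
      a + (a + ξ * inv a) * u + a * u     ≈⟨ +-congʳ (+-congˡ (begin
        (a + ξ * inv a) * u ≈⟨ *-congʳ a+ξ/a≈a*v ⟩
        a * v * u           ≈⟨ *-assoc a v u ⟩
        a * (v * u)         ≈⟨ *-congˡ v*u≈1 ⟩
        a * 1#              ≈⟨ *-identityʳ a ⟩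
        a                   ∎)) ⟩
      a + a + a * u                       ≈⟨ +-congʳ (x+x≈0 a) ⟩
      0# + a * u                          ≈⟨ +-identityˡ (a * u) ⟩
      a * u                               ∎

    closed-form : ∀ i → s (2 ℕ.* i) ≈ a * pow F u i × s (suc (2 ℕ.* i)) ≈ a * pow F v (suc i)
    closed-form zero    = sym (*-identityʳ a) , trans a+ξ/a≈a*v (*-congˡ (sym (*-identityʳ v)))
    closed-form (suc i) =
      trans (reflexive (≡.cong s (ℕ.*-suc 2 i))) even ,
      trans (reflexive (≡.cong (s ∘ suc) (ℕ.*-suc 2 i))) odd
      where
      uⁱ vⁱ⁺¹ : Carrier
      uⁱ   = pow F u i
      vⁱ⁺¹ = pow F v (suc i)

      even : s (suc (suc (2 ℕ.* i))) ≈ a * pow F u (suc i)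
      even = begin
        s (2 ℕ.* i) + ξ * inv (s (suc (2 ℕ.* i)))
          ≈⟨ +-cong (proj₁ (closed-form i))
                    (*-congˡ (inv-scaled-unit a≉0 (proj₂ (closed-form i)) (pow-*-pow≈1 v*u≈1 (suc i)))) ⟩
        a * uⁱ + ξ * (inv a * (u * uⁱ))
          ≈⟨ solve 5 (λ a U ξ i u → a :* U :+ ξ :* (i :* (u :* U)) := (a :+ ξ :* i :* u) :* U)
                     refl a uⁱ ξ (inv a) u ⟩
        (a + ξ * inv a * u) * uⁱ ≈⟨ *-congʳ a+ξu/a≈a*u ⟩
        a * u * uⁱ               ≈⟨ *-assoc a u uⁱ ⟩
        a * (u * uⁱ)             ∎

      odd : s (suc (suc (suc (2 ℕ.* i)))) ≈ a * pow F v (suc (suc i))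
      odd = begin
        s (suc (2 ℕ.* i)) + ξ * inv (s (suc (suc (2 ℕ.* i))))
          ≈⟨ +-cong (proj₂ (closed-form i))
                    (*-congˡ (inv-scaled-unit a≉0 even (pow-*-pow≈1 u*v≈1 (suc i)))) ⟩
        a * vⁱ⁺¹ + ξ * (inv a * vⁱ⁺¹)
          ≈⟨ solve 4 (λ a V ξ i → a :* V :+ ξ :* (i :* V) := (a :+ ξ :* i) :* V) refl a vⁱ⁺¹ ξ (inv a) ⟩
        (a + ξ * inv a) * vⁱ⁺¹ ≈⟨ *-congʳ a+ξ/a≈a*v ⟩
        a * v * vⁱ⁺¹           ≈⟨ *-assoc a v vⁱ⁺¹ ⟩
        a * (v * vⁱ⁺¹)         ∎

    a*w≈a⇒w≈1 : ∀ {w} → a * w ≈ a → w ≈ 1#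
    a*w≈a⇒w≈1 a*w≈a = *-cancelˡ-≉0 a≉0 (trans a*w≈a (sym (*-identityʳ a)))

    periodic-if-uᵏ≈1 : ∀ k → pow F u k ≈ 1# → Periodic (2 ℕ.* k)
    periodic-if-uᵏ≈1 k uᵏ≈1 i with even-or-odd i
    ... | inj₁ (j , ≡.refl) = begin
      s (2 ℕ.* j ℕ.+ 2 ℕ.* k)  ≡⟨ ≡.cong s (ℕ.*-distribˡ-+ 2 j k) ⟨
      s (2 ℕ.* (j ℕ.+ k))      ≈⟨ proj₁ (closed-form (j ℕ.+ k)) ⟩
      a * pow F u (j ℕ.+ k)    ≈⟨ *-congˡ (pow-+-≈1 k uᵏ≈1 j) ⟩
      a * pow F u j            ≈⟨ proj₁ (closed-form j) ⟨
      s (2 ℕ.* j)              ∎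
    ... | inj₂ (j , ≡.refl) = begin
      s (suc (2 ℕ.* j ℕ.+ 2 ℕ.* k)) ≡⟨ ≡.cong (s ∘ suc) (ℕ.*-distribˡ-+ 2 j k) ⟨
      s (suc (2 ℕ.* (j ℕ.+ k)))     ≈⟨ proj₂ (closed-form (j ℕ.+ k)) ⟩
      a * pow F v (suc j ℕ.+ k)     ≈⟨ *-congˡ (pow-+-≈1 k (pow≈1-transfer u*v≈1 k uᵏ≈1) (suc j)) ⟩
      a * pow F v (suc j)           ≈⟨ proj₂ (closed-form j) ⟨
      s (suc (2 ℕ.* j))             ∎

    even-period⇒uʲ≈1 : ∀ j → Periodic (2 ℕ.* j) → pow F u j ≈ 1#
    even-period⇒uʲ≈1 j periodic = a*w≈a⇒w≈1 (trans (sym (proj₁ (closed-form j))) (periodic 0))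

    no-odd-period : ∀ j → ¬ Periodic (suc (2 ℕ.* j))
    no-odd-period j periodic = v≉1 (a*w≈a⇒w≈1 (begin
      a * v                      ≈⟨ a+ξ/a≈a*v ⟨
      s 1                        ≈⟨ periodic 1 ⟨
      s (suc (suc (2 ℕ.* j)))    ≡⟨ ≡.cong s (ℕ.*-suc 2 j) ⟨
      s (2 ℕ.* suc j)            ≈⟨ proj₁ (closed-form (suc j)) ⟩
      a * pow F u (suc j)        ≈⟨ *-congˡ (pow≈1-transfer v*u≈1 (suc j) vʲ⁺¹≈1) ⟩
      a * 1#                     ≈⟨ *-identityʳ a ⟩
      a                          ∎))
      where
      vʲ⁺¹≈1 : pow F v (suc j) ≈ 1#
      vʲ⁺¹≈1 = a*w≈a⇒w≈1 (trans (sym (proj₂ (closed-form j))) (periodic 0))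

    period : ∀ k → IsOrder F (1# + div F ξ (a * a)) k → IsPeriod F s (2 ℕ.* k)
    period k (1≤k , xᵏ≈1 , order-minimal) =
      ℕ.≤-trans 1≤k (ℕ.m≤n*m k 2) , periodic-if-uᵏ≈1 k uᵏ≈1 , period-minimal
      where
      uᵏ≈1 : pow F u k ≈ 1#
      uᵏ≈1 = pow≈1-transfer v*u≈1 k (trans (pow-congˡ k (sym 1+ξ/a²≈v)) xᵏ≈1)

      period-minimal : ∀ q → 1 ℕ.≤ q → Periodic q → 2 ℕ.* k ℕ.≤ q
      period-minimal q 1≤q periodic with even-or-odd q
      period-minimal _ () _        | inj₁ (zero , ≡.refl)
      period-minimal _ _  periodic | inj₁ (suc j , ≡.refl) =
        ℕ.*-monoʳ-≤ 2 (order-minimal (suc j) (s≤s z≤n)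
          (trans (pow-congˡ (suc j) 1+ξ/a²≈v) (pow≈1-transfer u*v≈1 (suc j) (even-period⇒uʲ≈1 (suc j) periodic))))
      period-minimal _ _  periodic | inj₂ (j , ≡.refl) = ⊥-elim (no-odd-period j periodic)

lemma4p4 : (n : ℕ) (F : GF2^ n) → let open GF2^ F in
    (ξ a : Carrier) → ¬ (ξ ≈ 0#) → ¬ (a ≈ 0#) → ¬ (a * a ≈ ξ) →
    (∀ i → seqS F ξ a (2 ℕ.* i) ≈ a * pow F (div F (a * a) (a * a + ξ)) i
    × seqS F ξ a (suc (2 ℕ.* i)) ≈ a * pow F (div F (a * a + ξ) (a * a)) (suc i))
    × (∀ k → IsOrder F (1# + div F ξ (a * a)) k → IsPeriod F (seqS F ξ a) (2 ℕ.* k))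
lemma4p4 n F ξ a ξ≉0 a≉0 a²≉ξ = closed-form ξ≉0 a≉0 a²≉ξ , period ξ≉0 a≉0 a²≉ξ
  where open Orbit F ξ a
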